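{- Let $n\ge 3$ and $0\le k\le n-1$. The unidirectional cycle $\overrightarrow{C_n}$ is $(\{0,1,\dots,n-1\}\setminus\{k\})$-antimagic.
   Context: The unidirectional cycle $\overrightarrow{C_n}$ has vertices $v_1,\dots,v_n$ and arcs $(v_i,v_{i+1})$ for $1\le i\le n-1$ and $(v_n,v_1)$, so $d(v_i,v_j)=(j-i)\bmod n$, where $d(u,y)$ is the length of a shortest directed path. $N_D(v)=\{y:d(v,y)\in D\}$; a bijection $f:V\to\{1,\dots,n\}$ is $D$-antimagic if $\omega_D(v)=\sum_{y\in N_D(v)}f(y)$ are pairwise distinct; the graph is $D$-antimagic if such a bijection exists. -}

module Defs where

open import Data.Nat using (ℕ; zero; suc; _+_; _∸_; _<_; _≟_)
open import Data.Nat.DivMod using (_%_)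
open import Data.Fin using (Fin; toℕ)
open import Data.Fin.Permutation using (Permutation′; _⟨$⟩ʳ_)
open import Data.List using (List; map; filter)
open import Data.Nat.ListAction using (sum)
open import Data.Product using (∃; _×_)
open import Data.List.Base using (allFin)
open import Data.Bool using (Bool; true; false)
open import Relation.Nullary using (Dec; yes; no; ¬_)
open import Relation.Nullary.Decidable using (⌊_⌋)
open import Relation.Unary using (Pred; Decidable)
open import Relation.Binary.PropositionalEquality using (_≡_)
open import Function.Definitions using (Injective)
open import Level using (0ℓ)

-- Vertices of the unidirectional cycle C_n are Fin n; vertex i corresponds to v_{i+1}.
-- Arcs: i → i+1 (mod n).  Directed distance d(i,j) = (j - i) mod n.
dist : (n : ℕ) → Fin n → Fin n → ℕ
dist zero () _
dist (suc m) i j = (toℕ j + (suc m ∸ toℕ i)) % suc m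

nbhd : (n : ℕ) (D : Pred ℕ 0ℓ) → Decidable D → Fin n → List (Fin n)
nbhd n D D? v = filter (λ y → D? (dist n v y)) (allFin n)

-- A labelling f : V → {1,…,n} that is a bijection is given by a permutation σ of Fin n,
-- with f(y) = 1 + σ(y).
label : {n : ℕ} → Permutation′ n → Fin n → ℕ
label σ y = suc (toℕ (σ ⟨$⟩ʳ y))

weight : (n : ℕ) (D : Pred ℕ 0ℓ) → Decidable D → Permutation′ n → Fin n → ℕ
weight n D D? σ v = sum (map (label σ) (nbhd n D D? v))

IsDAntimagicLabelling : (n : ℕ) (D : Pred ℕ 0ℓ) → Decidable D → Permutation′ n → Set
IsDAntimagicLabelling n D D? σ = Injective _≡_ _≡_ (weight n D D? σ)

CycleDAntimagic : (n : ℕ) (D : Pred ℕ 0ℓ) → Decidable D → Set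
CycleDAntimagic n D D? = ∃ λ (σ : Permutation′ n) → IsDAntimagicLabelling n D D? σ

DminusK : (n k : ℕ) → Pred ℕ 0ℓ
DminusK n k d = (d < n) × ¬ (d ≡ k)

DminusK? : (n k : ℕ) → Decidable (DminusK n k)
DminusK? n k d = (d <? n) ×-dec (¬? (d ≟ k))
  where
  open import Data.Nat using (_<?_)
  open import Relation.Nullary.Decidable using (_×-dec_; ¬?)

{-# OPTIONS --safe #-}
module Submission where

-- Since D = {0,…,n-1} \ {k}, the D-neighbourhood of v is every vertex except v + k (mod n).
-- Hence ω(v) = (1 + 2 + ⋯ + n) − f(v + k), and as v ↦ v + k and f are injective, so is ω:
-- every bijective labelling is D-antimagic, for every n ≥ 1.

open import Defs
open import Data.Nat using (ℕ; suc; _+_; _∸_; _≤_; _<_; NonZero)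
open import Data.Nat.Properties using (+-comm; +-assoc; +-cancelˡ-≡; m+[n∸m]≡n; m∸n+n≡m; <⇒≤; suc-injective)
open import Data.Nat.DivMod using (_%_; %-distribˡ-+; m%n%n≡m%n; [m+n]%n≡m%n; m%n<n; m<n⇒m%n≡m)
open import Data.Nat.ListAction using (sum)
open import Data.Fin using (Fin; toℕ; fromℕ<)
open import Data.Fin.Properties using (toℕ-fromℕ<; toℕ-injective; toℕ<n)
open import Data.Fin.Permutation as Permutation using (Permutation′)
open import Data.List using (List; _∷_; map; filter; allFin)
open import Data.List.Properties using (filter-all; filter-accept; filter-reject)
open import Data.List.Relation.Unary.All as All using ()
open import Data.List.Relation.Unary.Any using (here; there)
open import Data.List.Relation.Unary.AllPairs using (_∷_)
open import Data.List.Relation.Unary.Unique.Propositional using (Unique)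
open import Data.List.Relation.Unary.Unique.Propositional.Properties using (allFin⁺)
open import Data.List.Membership.Propositional using (_∈_)
open import Data.List.Membership.Propositional.Properties using (∈-allFin)
open import Data.Product using (_,_)
open import Function.Base using (_∘_)
open import Function.Bundles using (Injection)
open import Function.Definitions using (Injective)
open import Function.Properties.Inverse using (↔⇒↣)
open import Relation.Nullary using (¬_)
open import Relation.Unary using (Pred; Decidable)
open import Relation.Binary.PropositionalEquality
open import Level using (0ℓ)

open ≡-Reasoning

[m%d+n]%d≡[m+n]%d : ∀ m n d .{{_ : NonZero d}} → (m % d + n) % d ≡ (m + n) % d
[m%d+n]%d≡[m+n]%d m n d = begin
  (m % d + n) % d          ≡⟨ %-distribˡ-+ (m % d) n d ⟩
  (m % d % d + n % d) % d  ≡⟨ cong (λ r → (r + n % d) % d) (m%n%n≡m%n m d) ⟩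
  (m % d + n % d) % d      ≡⟨ %-distribˡ-+ m n d ⟨
  (m + n) % d              ∎

sum-filter-+-rejected : ∀ {A : Set} {P : Pred A 0ℓ} (P? : Decidable P) (g : A → ℕ) {x : A} {xs : List A} →
  Unique xs → x ∈ xs → ¬ P x → (∀ {y} → y ≢ x → P y) →
  sum (map g (filter P? xs)) + g x ≡ sum (map g xs)
sum-filter-+-rejected P? g {x} {x ∷ xs} (x≢xs ∷ _) (here refl) ¬Px Pothers
  rewrite filter-reject P? {x} {xs} ¬Px
        | filter-all P? {xs} (All.map (Pothers ∘ ≢-sym) x≢xs)
  = +-comm (sum (map g xs)) (g x)
sum-filter-+-rejected P? g {x} {z ∷ xs} (z≢xs ∷ unique) (there x∈xs) ¬Px Pothers
  rewrite filter-accept P? {z} {xs} (Pothers (All.lookup z≢xs x∈xs))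
  = trans (+-assoc (g z) _ (g x)) (cong (g z +_) (sum-filter-+-rejected P? g unique x∈xs ¬Px Pothers))

module _ {n : ℕ} where

  rotate : ℕ → Fin (suc n) → Fin (suc n)
  rotate k v = fromℕ< (m%n<n (toℕ v + k) (suc n))

  toℕ-rotate : ∀ k v → toℕ (rotate k v) ≡ (toℕ v + k) % suc n
  toℕ-rotate k v = toℕ-fromℕ< (m%n<n (toℕ v + k) (suc n))

  rotate-rotate : ∀ j k v → rotate j (rotate k v) ≡ rotate (k + j) v
  rotate-rotate j k v = toℕ-injective (begin
    toℕ (rotate j (rotate k v))  ≡⟨ toℕ-rotate j (rotate k v) ⟩
    (toℕ (rotate k v) + j) % suc n ≡⟨ cong (λ r → (r + j) % suc n) (toℕ-rotate k v) ⟩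
    ((toℕ v + k) % suc n + j) % suc n ≡⟨ [m%d+n]%d≡[m+n]%d (toℕ v + k) j (suc n) ⟩
    (toℕ v + k + j) % suc n      ≡⟨ cong (_% suc n) (+-assoc (toℕ v) k j) ⟩
    (toℕ v + (k + j)) % suc n    ≡⟨ toℕ-rotate (k + j) v ⟨
    toℕ (rotate (k + j) v)       ∎)

  rotate-full : ∀ v → rotate (suc n) v ≡ v
  rotate-full v = toℕ-injective (begin
    toℕ (rotate (suc n) v)   ≡⟨ toℕ-rotate (suc n) v ⟩
    (toℕ v + suc n) % suc n  ≡⟨ [m+n]%n≡m%n (toℕ v) (suc n) ⟩
    toℕ v % suc n            ≡⟨ m<n⇒m%n≡m (toℕ<n v) ⟩
    toℕ v                    ∎)

  rotate-inverseˡ : ∀ {k} → k ≤ suc n → ∀ v → rotate (suc n ∸ k) (rotate k v) ≡ v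
  rotate-inverseˡ {k} k≤n v = begin
    rotate (suc n ∸ k) (rotate k v) ≡⟨ rotate-rotate (suc n ∸ k) k v ⟩
    rotate (k + (suc n ∸ k)) v      ≡⟨ cong (λ j → rotate j v) (m+[n∸m]≡n k≤n) ⟩
    rotate (suc n) v                ≡⟨ rotate-full v ⟩
    v                               ∎

  rotate-inverseʳ : ∀ {k} → k ≤ suc n → ∀ v → rotate k (rotate (suc n ∸ k) v) ≡ v
  rotate-inverseʳ {k} k≤n v = begin
    rotate k (rotate (suc n ∸ k) v) ≡⟨ rotate-rotate k (suc n ∸ k) v ⟩
    rotate (suc n ∸ k + k) v        ≡⟨ cong (λ j → rotate j v) (m∸n+n≡m k≤n) ⟩
    rotate (suc n) v                ≡⟨ rotate-full v ⟩
    v                               ∎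

  rotate-injective : ∀ {k} → k ≤ suc n → Injective _≡_ _≡_ (rotate k)
  rotate-injective {k} k≤n {u} {v} ru≡rv = begin
    u                                ≡⟨ rotate-inverseˡ k≤n u ⟨
    rotate (suc n ∸ k) (rotate k u)  ≡⟨ cong (rotate (suc n ∸ k)) ru≡rv ⟩
    rotate (suc n ∸ k) (rotate k v)  ≡⟨ rotate-inverseˡ k≤n v ⟩
    v                                ∎

  rotate-toℕ-comm : ∀ u v → rotate (toℕ u) v ≡ rotate (toℕ v) u
  rotate-toℕ-comm u v = toℕ-injective (begin
    toℕ (rotate (toℕ u) v)    ≡⟨ toℕ-rotate (toℕ u) v ⟩
    (toℕ v + toℕ u) % suc n   ≡⟨ cong (_% suc n) (+-comm (toℕ v) (toℕ u)) ⟩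
    (toℕ u + toℕ v) % suc n   ≡⟨ toℕ-rotate (toℕ v) u ⟨
    toℕ (rotate (toℕ v) u)    ∎)

  dist≡toℕ-rotate : ∀ v y → dist (suc n) v y ≡ toℕ (rotate (suc n ∸ toℕ v) y)
  dist≡toℕ-rotate v y = sym (toℕ-rotate (suc n ∸ toℕ v) y)

  dist<n : ∀ v y → dist (suc n) v y < suc n
  dist<n v y = m%n<n (toℕ y + (suc n ∸ toℕ v)) (suc n)

  dist-rotate : ∀ {k} → k < suc n → ∀ v → dist (suc n) v (rotate k v) ≡ k
  dist-rotate {k} k<n v = begin
    dist (suc n) v (rotate k v)                      ≡⟨ dist≡toℕ-rotate v (rotate k v) ⟩
    toℕ (rotate (suc n ∸ toℕ v) (rotate k v))        ≡⟨ cong (toℕ ∘ rotate (suc n ∸ toℕ v)) rotate-k-v ⟩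
    toℕ (rotate (suc n ∸ toℕ v) (rotate (toℕ v) k′)) ≡⟨ cong toℕ (rotate-inverseˡ (<⇒≤ (toℕ<n v)) k′) ⟩
    toℕ k′                                           ≡⟨ toℕ-fromℕ< k<n ⟩
    k                                                ∎
    where
    k′ : Fin (suc n)
    k′ = fromℕ< k<n
    rotate-k-v : rotate k v ≡ rotate (toℕ v) k′
    rotate-k-v = trans (cong (λ j → rotate j v) (sym (toℕ-fromℕ< k<n))) (rotate-toℕ-comm k′ v)

  dist≡⇒≡rotate : ∀ {k} v y → dist (suc n) v y ≡ k → y ≡ rotate k v
  dist≡⇒≡rotate {k} v y dist≡k = begin
    y                                          ≡⟨ rotate-inverseʳ (<⇒≤ (toℕ<n v)) y ⟨
    rotate (toℕ v) (rotate (suc n ∸ toℕ v) y)  ≡⟨ rotate-toℕ-comm v (rotate (suc n ∸ toℕ v) y) ⟩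
    rotate (toℕ (rotate (suc n ∸ toℕ v) y)) v  ≡⟨ cong (λ j → rotate j v) (trans (sym (dist≡toℕ-rotate v y)) dist≡k) ⟩
    rotate k v                                 ∎

label-injective : ∀ {n} (σ : Permutation′ n) → Injective _≡_ _≡_ (label σ)
label-injective σ = Injection.injective (↔⇒↣ σ) ∘ toℕ-injective ∘ suc-injective

module _ {n k : ℕ} (k<n : k < suc n) where

  ω : Permutation′ (suc n) → Fin (suc n) → ℕ
  ω = weight (suc n) (DminusK (suc n) k) (DminusK? (suc n) k)

  weight-+-label-rotate : ∀ σ v → ω σ v + label σ (rotate k v) ≡ sum (map (label σ) (allFin (suc n)))
  weight-+-label-rotate σ v =
    sum-filter-+-rejected (λ y → DminusK? (suc n) k (dist (suc n) v y)) (label σ)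
      (allFin⁺ (suc n)) (∈-allFin (rotate k v))
      (λ (_ , dist≢k) → dist≢k (dist-rotate k<n v))
      (λ {y} y≢rotate → dist<n v y , y≢rotate ∘ dist≡⇒≡rotate v y)

  every-labelling-antimagic : ∀ σ → IsDAntimagicLabelling (suc n) (DminusK (suc n) k) (DminusK? (suc n) k) σ
  every-labelling-antimagic σ {u} {v} ωu≡ωv =
    rotate-injective (<⇒≤ k<n) (label-injective σ (+-cancelˡ-≡ (ω σ u) _ _ (begin
      ω σ u + label σ (rotate k u)  ≡⟨ weight-+-label-rotate σ u ⟩
      sum (map (label σ) (allFin (suc n))) ≡⟨ weight-+-label-rotate σ v ⟨
      ω σ v + label σ (rotate k v)  ≡⟨ cong (_+ label σ (rotate k v)) ωu≡ωv ⟨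
      ω σ u + label σ (rotate k v)  ∎)))

mainTheorem15 : (n k : ℕ) → 3 ≤ n → k < n →
    CycleDAntimagic n (DminusK n k) (DminusK? n k)
mainTheorem15 (suc n) k _ k<n = Permutation.id , every-labelling-antimagic k<n Permutation.id
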